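{- ${DL}(\partial_{||})$ is not more expressive than ${DL}(\partial)$ with respect to addition of rules: there is a propositional defeasible theory $D$ such that no propositional defeasible theory $D'$ in ${DL}(\partial_{||})$ simulates $D$ in ${DL}(\partial)$ with respect to addition of rules.
   Context: Literals are propositions or their negations; ${\sim}q$ is the complement of $q$. A propositional defeasible theory is $D=(F,R,>)$: $F$ finite set of literals, $R$ finite set of labelled rules, $>$ acyclic binary relation on $R$. Each rule has a finite antecedent set $A(r)$ and consequent literal and is strict ($\rightarrow$), defeasible ($\Rightarrow$) or a defeater ($\leadsto$). $R_s$: strict rules; $R_{sd}$: strict and defeasible rules; $R[q]$: rules with consequent $q$. A proof $P$ is a sequence of tagged literals, $P(1..i)$ its first $i$ elements; a conclusion is a consequence if it occurs in some proof. $\Sigma(D)$ is the set of propositions and $\Lambda(D)$ the set of rule/fact labels of $D$. $+\Delta$: append $+\Delta q$ if $q\in F$ or some $r\in R_s[q]$ has $+\Delta a\in P(1..i)$ for all $a\in A(r)$. $-\Delta$: append $-\Delta q$ if $q\notin F$ and every $r\in R_s[q]$ has some $a\in A(r)$ with $-\Delta a\in P(1..i)$. ${DL}(\partial)$: tags $\Delta,\partial$. $+\partial$: append $+\partial q$ if (1) $+\Delta q\in P(1..i)$, or (2.1) some $r\in R_{sd}[q]$ has $+\partial a\in P(1..i)$ for all $a\in A(r)$, (2.2) $-\Delta{\sim}q\in P(1..i)$, (2.3) every $s\in R[{\sim}q]$ has some $a\in A(s)$ with $-\partial a\in P(1..i)$, or some $t\in R_{sd}[q]$ with $t>s$ has $+\partial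 a\in P(1..i)$ for all $a\in A(t)$. $-\partial$: append $-\partial q$ if $-\Delta q\in P(1..i)$ and either every $r\in R_{sd}[q]$ has some $a\in A(r)$ with $-\partial a\in P(1..i)$, or $+\Delta{\sim}q\in P(1..i)$, or some $s\in R[{\sim}q]$ has $+\partial a\in P(1..i)$ for all $a\in A(s)$ and every $t\in R_{sd}[q]$ either has some $a\in A(t)$ with $-\partial a\in P(1..i)$ or not $t>s$. ${DL}(\partial_{||})$: tags $\Delta,\lambda,\partial_{||}$. $P_\Delta$: all $\pm\Delta$ conclusions derivable. $+\lambda$: append $+\lambda q$ if $+\Delta q\in P_\Delta$, or some $r\in R_{sd}[q]$ has $+\lambda a\in P(1..i)$ for all $a\in A(r)$ and $+\Delta{\sim}q\notin P_\Delta$. $-\lambda$: append $-\lambda q$ if $-\Delta q\in P_\Delta$ and either every $r\in R_{sd}[q]$ has some $a\in A(r)$ with $-\lambda a\in P(1..i)$, or $+\Delta{\sim}q\in P_\Delta$. $P_\lambda$: all $\pm\lambda$ conclusions derivable. $+\partial_{||}$: append $+\partial_{||}q$ if (1) $+\Delta q\in P_\Delta$, or (2.1) some $r\in R_{sd}[q]$ has $+\partial_{||}a\in P(1..i)$ for all $a\in A(r)$, (2.2) $+\Delta{\sim}q\notin P_\Delta$, (2.3) every $s\in R[{\sim}q]$ has some $a\in A(s)$ with $+\lambda a\notin P_\lambda$, or some $t\in R_{sd}[q]$ with $t>s$ has $+\partial_{||}a\in P(1..i)$ for all $a\in A(t)$. $-\partial_{||}$: append $-\partial_{||}q$ if $-\Delta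 q\in P_\Delta$ and either every $r\in R_{sd}[q]$ has some $a\in A(r)$ with $-\partial_{||}a\in P(1..i)$, or $+\Delta{\sim}q\in P_\Delta$, or some $s\in R[{\sim}q]$ has $+\lambda a\in P_\lambda$ for all $a\in A(s)$ and every $t\in R_{sd}[q]$ either has some $a\in A(t)$ with $-\partial_{||}a\in P(1..i)$ or not $t>s$. The addition of theories is $(F_1,R_1,>_1)+(F_2,R_2,>_2)=(F_1\cup F_2,R_1\cup R_2,>_1\cup>_2)$. Given $D$ and a candidate simulating theory $D'$, an addition $A$ is modular if $\Sigma(A)\cap\Sigma(D')\subseteq\Sigma(D)$, $\Lambda(D)\cap\Lambda(A)=\emptyset$ and $\Lambda(D')\cap\Lambda(A)=\emptyset$. $D$ in ${DL}(\partial)$ is simulated by $D'$ in ${DL}(\partial_{||})$ with respect to addition of rules if for every modular addition $A$ consisting only of rules (no facts, empty superiority relation), $D+A$ and $D'+A$ have the same consequences on literals over $\Sigma(D+A)$ modulo tags: $\pm\Delta q$ is a consequence of $D+A$ iff of $D'+A$, and $\pm\partial q$ is a consequence of $D+A$ in ${DL}(\partial)$ iff $\pm\partial_{||}q$ is a consequence of $D'+A$ in ${DL}(\partial_{||})$. -}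

module Defs where

open import Data.Nat using (ℕ)
open import Data.List using (List; []; _∷_; _++_; map)
open import Data.List.Membership.Propositional using (_∈_)
open import Data.List.Relation.Unary.All using (All)
open import Data.List.Relation.Unary.Any using (Any)
open import Data.List.Relation.Unary.Unique.Propositional using (Unique)
open import Data.Product using (Σ; ∃-syntax; _×_; _,_)
open import Data.Sum using (_⊎_)
open import Relation.Binary.PropositionalEquality using (_≡_)
open import Relation.Nullary using (¬_)
open import Relation.Binary.Construct.Closure.Transitive using (TransClosure)
open import Function.Bundles using (_⇔_)

Prop : Set
Prop = ℕ

Label : Set
Label = ℕ

data Lit : Set where
  pos : Prop → Lit
  neg : Prop → Lit

∼_ : Lit → Lit
∼ pos p = neg p
∼ neg p = pos p

atom : Lit → Prop
atom (pos p) = p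
atom (neg p) = p

data Kind : Set where
  strict defeasible defeater : Kind

data SD : Kind → Set where
  sd-strict : SD strict
  sd-defeasible : SD defeasible

record Rule : Set where
  constructor rule
  field
    label : Label
    kind  : Kind
    ante  : List Lit
    head  : Lit
open Rule public

record Theory : Set where
  constructor theory
  field
    facts : List Lit
    rules : List Rule
    sup   : List (Label × Label)
open Theory public

_>[_]_ : Rule → Theory → Rule → Set
t >[ D ] s = (label t , label s) ∈ sup D

_∈Λ_ : Label → Theory → Set
l ∈Λ D = l ∈ map label (rules D)

_∈Σ_ : Prop → Theory → Set
p ∈Σ D = Any (λ l → atom l ≡ p) (facts D)
       ⊎ Any (λ r → atom (head r) ≡ p ⊎ Any (λ l → atom l ≡ p) (ante r)) (rules D)

SupRel : Theory → Label → Label → Set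
SupRel D a b = (a , b) ∈ sup D

record WellFormed (D : Theory) : Set where
  field
    labels-unique : Unique (map label (rules D))
    sup-on-rules  : ∀ a b → (a , b) ∈ sup D → a ∈Λ D × b ∈Λ D
    acyclic       : ∀ a → ¬ TransClosure (SupRel D) a a

_⊕_ : Theory → Theory → Theory
D₁ ⊕ D₂ = theory (facts D₁ ++ facts D₂) (rules D₁ ++ rules D₂) (sup D₁ ++ sup D₂)

data Sign : Set where
  plus minus : Sign

-- ±Δ conditions, parametrised by the set of Δ-conclusions available
-- (has s a  means  sΔ a ∈ P(1..i))

ΔCond : Theory → (Sign → Lit → Set) → Sign → Lit → Set
ΔCond D has plus q =
  q ∈ facts D
  ⊎ ∃[ r ] (r ∈ rules D × kind r ≡ strict × head r ≡ q × All (has plus) (ante r))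
ΔCond D has minus q =
  ¬ (q ∈ facts D)
  × (∀ r → r ∈ rules D → kind r ≡ strict → head r ≡ q → Any (has minus) (ante r))

data Tag∂ : Set where
  Δ ∂ : Tag∂

record TL∂ : Set where
  constructor ⟨_,_,_⟩
  field
    sign : Sign
    tag  : Tag∂
    lit  : Lit

module _ (D : Theory) (P : List TL∂) where
  private
    InΔ : Sign → Lit → Set
    InΔ s a = ⟨ s , Δ , a ⟩ ∈ P
    In∂ : Sign → Lit → Set
    In∂ s a = ⟨ s , ∂ , a ⟩ ∈ P

  ∂Cond : Sign → Lit → Set
  ∂Cond plus q =
    InΔ plus q
    ⊎ (∃[ r ] (r ∈ rules D × SD (kind r) × head r ≡ q × All (In∂ plus) (ante r))
       × InΔ minus (∼ q)
       × (∀ s → s ∈ rules D → head s ≡ ∼ q →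
            Any (In∂ minus) (ante s)
            ⊎ ∃[ t ] (t ∈ rules D × SD (kind t) × head t ≡ q × t >[ D ] s
                       × All (In∂ plus) (ante t))))
  ∂Cond minus q =
    InΔ minus q
    × ((∀ r → r ∈ rules D → SD (kind r) → head r ≡ q → Any (In∂ minus) (ante r))
       ⊎ InΔ plus (∼ q)
       ⊎ ∃[ s ] (s ∈ rules D × head s ≡ ∼ q × All (In∂ plus) (ante s)
                 × (∀ t → t ∈ rules D → SD (kind t) → head t ≡ q →
                      Any (In∂ minus) (ante t) ⊎ ¬ (t >[ D ] s))))

  Step∂ : TL∂ → Set
  Step∂ ⟨ s , Δ , q ⟩ = ΔCond D InΔ s q
  Step∂ ⟨ s , ∂ , q ⟩ = ∂Cond s q

-- Proofs are stored newest-first: (x ∷ P) extends the proof P(1..i) = P by x.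
data Proof∂ (D : Theory) : List TL∂ → Set where
  []  : Proof∂ D []
  _∷_ : ∀ {P x} → Step∂ D P x → Proof∂ D P → Proof∂ D (x ∷ P)

Cons∂ : Theory → TL∂ → Set
Cons∂ D x = ∃[ P ] (Proof∂ D P × x ∈ P)

data ProofΔ (D : Theory) : List (Sign × Lit) → Set where
  []  : ProofΔ D []
  _∷_ : ∀ {P s q} → ΔCond D (λ s' a → (s' , a) ∈ P) s q → ProofΔ D P
        → ProofΔ D ((s , q) ∷ P)

PΔ : Theory → Sign → Lit → Set
PΔ D s q = ∃[ P ] (ProofΔ D P × (s , q) ∈ P)

λCond : Theory → List (Sign × Lit) → Sign → Lit → Set
λCond D P plus q =
  PΔ D plus q
  ⊎ (∃[ r ] (r ∈ rules D × SD (kind r) × head r ≡ q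
             × All (λ a → (plus , a) ∈ P) (ante r))
     × ¬ PΔ D plus (∼ q))
λCond D P minus q =
  PΔ D minus q
  × ((∀ r → r ∈ rules D → SD (kind r) → head r ≡ q
        → Any (λ a → (minus , a) ∈ P) (ante r))
     ⊎ PΔ D plus (∼ q))

data Proofλ (D : Theory) : List (Sign × Lit) → Set where
  []  : Proofλ D []
  _∷_ : ∀ {P s q} → λCond D P s q → Proofλ D P → Proofλ D ((s , q) ∷ P)

Pλ : Theory → Sign → Lit → Set
Pλ D s q = ∃[ P ] (Proofλ D P × (s , q) ∈ P)

∂∥Cond : Theory → List (Sign × Lit) → Sign → Lit → Set
∂∥Cond D P plus q =
  PΔ D plus q
  ⊎ (∃[ r ] (r ∈ rules D × SD (kind r) × head r ≡ q
             × All (λ a → (plus , a) ∈ P) (ante r))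
     × ¬ PΔ D plus (∼ q)
     × (∀ s → s ∈ rules D → head s ≡ ∼ q →
          Any (λ a → ¬ Pλ D plus a) (ante s)
          ⊎ ∃[ t ] (t ∈ rules D × SD (kind t) × head t ≡ q × t >[ D ] s
                    × All (λ a → (plus , a) ∈ P) (ante t))))
∂∥Cond D P minus q =
  PΔ D minus q
  × ((∀ r → r ∈ rules D → SD (kind r) → head r ≡ q
        → Any (λ a → (minus , a) ∈ P) (ante r))
     ⊎ PΔ D plus (∼ q)
     ⊎ ∃[ s ] (s ∈ rules D × head s ≡ ∼ q × All (Pλ D plus) (ante s)
               × (∀ t → t ∈ rules D → SD (kind t) → head t ≡ q →
                    Any (λ a → (minus , a) ∈ P) (ante t) ⊎ ¬ (t >[ D ] s))))

data Proof∂∥ (D : Theory) : List (Sign × Lit) → Set where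
  []  : Proof∂∥ D []
  _∷_ : ∀ {P s q} → ∂∥Cond D P s q → Proof∂∥ D P → Proof∂∥ D ((s , q) ∷ P)

Cons∂∥ : Theory → Sign → Lit → Set
Cons∂∥ D s q = ∃[ P ] (Proof∂∥ D P × (s , q) ∈ P)

record Modular (D D' A : Theory) : Set where
  field
    sig   : ∀ p → p ∈Σ A → p ∈Σ D' → p ∈Σ D
    lab   : ∀ l → l ∈Λ D → ¬ (l ∈Λ A)
    lab'  : ∀ l → l ∈Λ D' → ¬ (l ∈Λ A)

Simulates : Theory → Theory → Set
Simulates D D' =
  ∀ A → WellFormed A → facts A ≡ [] → sup A ≡ [] → Modular D D' A →
  ∀ q → atom q ∈Σ (D ⊕ A) →
    (∀ s → Cons∂ (D ⊕ A) ⟨ s , Δ , q ⟩ ⇔ PΔ (D' ⊕ A) s q)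
    × (∀ s → Cons∂ (D ⊕ A) ⟨ s , ∂ , q ⟩ ⇔ Cons∂∥ (D' ⊕ A) s q)

module Submission where

-- The witness is the empty theory.  Given any well-formed D', pick a number N
-- above every proposition and label of D' and add the "ambiguity gadget" Amb
--     ⇒ p,   ⇒ ¬p,   ⇒ q,   p ⇒ ¬q          (p = N, q = N+1, labels N … N+3)
-- which is a modular addition because its vocabulary is fresh for D'.
--   * DL(∂) is ambiguity blocking: p is ambiguous, hence −∂p, so the only
--     attack p ⇒ ¬q on q is discarded and +∂q is derived.
--   * DL(∂∥) is ambiguity propagating: p is still supported (+λp), so the
--     attack p ⇒ ¬q survives; nothing in D' ⊕ Amb is superior to it (the
--     superiority relation of D' only mentions labels of D'), so +∂∥q is
--     never derivable.
-- Hence D' disagrees with the empty theory on q.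

open import Defs
open import Data.Product using (Σ; _×_; _,_; proj₂)
open import Relation.Nullary using (¬_)

open import Data.Nat using (ℕ; suc; _+_; _≤_; _<_; s≤s)
open import Data.Nat.ListAction using (sum)
open import Data.Nat.Properties using (≤-refl; ≤-reflexive; ≤-trans; m≤m+n; m≤n+m; n≤1+n; <⇒≱)
open import Data.List using (List; []; _∷_; map)
open import Data.List.Relation.Unary.Any as Any using (Any; here; there)
open import Data.List.Relation.Unary.Any.Properties using (map⁻)
open import Data.List.Relation.Unary.All as All using (All; []; _∷_)
open import Data.List.Relation.Unary.AllPairs using ([]; _∷_)
open import Data.List.Relation.Unary.Unique.Propositional using (Unique)
open import Data.List.Membership.Propositional using (_∈_)
open import Data.List.Membership.Propositional.Properties using (∈-++⁺ʳ; ∈-++⁻)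
open import Data.Empty using (⊥; ⊥-elim)
open import Data.Sum using (_⊎_; inj₁; inj₂)
open import Relation.Binary.PropositionalEquality using (_≡_; _≢_; refl; sym; cong; subst)
open import Relation.Binary.Construct.Closure.Transitive using ([_]; _∷_)
open import Function.Bundles using (Equivalence; _⇔_)

-- A strict upper bound on the vocabulary of a theory

litsSize : List Lit → ℕ
litsSize ls = sum (map atom ls)

ruleSize : Rule → ℕ
ruleSize r = label r + (atom (head r) + litsSize (ante r))

size : Theory → ℕ
size D = litsSize (facts D) + sum (map ruleSize (rules D))

≤-sum : ∀ {X : Set} {n} (f : X → ℕ) (xs : List X) →
        Any (λ x → n ≤ f x) xs → n ≤ sum (map f xs)
≤-sum f (x ∷ xs) (here n≤fx) = ≤-trans n≤fx (m≤m+n (f x) _)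
≤-sum f (x ∷ xs) (there i)   = ≤-trans (≤-sum f xs i) (m≤n+m _ (f x))

atom≤litsSize : ∀ {p} ls → Any (λ l → atom l ≡ p) ls → p ≤ litsSize ls
atom≤litsSize ls i = ≤-sum atom ls (Any.map (λ eq → ≤-reflexive (sym eq)) i)

atom≤ruleSize : ∀ {p r} → atom (head r) ≡ p ⊎ Any (λ l → atom l ≡ p) (ante r) → p ≤ ruleSize r
atom≤ruleSize {r = r} (inj₁ refl) = ≤-trans (m≤m+n _ _) (m≤n+m _ (label r))
atom≤ruleSize {r = r} (inj₂ i) =
  ≤-trans (atom≤litsSize (ante r) i) (≤-trans (m≤n+m _ _) (m≤n+m _ (label r)))

fresh : Theory → ℕ
fresh D = suc (size D)

∈Σ⇒<fresh : ∀ {p} D → p ∈Σ D → p < fresh D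
∈Σ⇒<fresh D (inj₁ i) = s≤s (≤-trans (atom≤litsSize (facts D) i) (m≤m+n _ _))
∈Σ⇒<fresh D (inj₂ i) =
  s≤s (≤-trans (≤-sum ruleSize (rules D) (Any.map (λ {r} → atom≤ruleSize {r = r}) i)) (m≤n+m _ _))

∈Λ⇒<fresh : ∀ {l} D → l ∈Λ D → l < fresh D
∈Λ⇒<fresh D i =
  s≤s (≤-trans (≤-sum ruleSize (rules D) (Any.map (λ { refl → m≤m+n _ _ }) (map⁻ i)))
               (m≤n+m _ _))

wellFormed-unordered : ∀ F R → Unique (map label R) → WellFormed (theory F R [])
wellFormed-unordered F R unique = record
  { labels-unique = unique
  ; sup-on-rules  = λ a b ()
  ; acyclic       = λ { a [ () ] ; a (() ∷ _) }
  }

noStrict⇒−Δ : ∀ R S → (∀ r → r ∈ R → kind r ≢ strict) →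
              ∀ P q → Step∂ (theory [] R S) P ⟨ minus , Δ , q ⟩
noStrict⇒−Δ R S nonStrict P q =
  (λ ()) , λ r r∈R isStrict _ → ⊥-elim (nonStrict r r∈R isStrict)

unsupported⇒¬+Δ : ∀ D {q} → ¬ (q ∈ facts D) →
                  (∀ r → r ∈ rules D → kind r ≡ strict → head r ≢ q) →
                  ¬ PΔ D plus q
unsupported⇒¬+Δ D {q} notFact notStrictHead (P , proof , +q∈P) = go proof +q∈P
  where
  go : ∀ {P} → ProofΔ D P → (plus , q) ∈ P → ⊥
  go (inj₁ q∈F ∷ _) (here refl) = notFact q∈F
  go (inj₂ (r , r∈R , isStrict , headr , _) ∷ _) (here refl) = notStrictHead r r∈R isStrict headr
  go (_ ∷ proof) (there i) = go proof i

module Gadget (N : ℕ) where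

  p q : Lit
  p = pos N
  q = pos (suc N)

  r-p r-¬p r-q r-¬q : Rule
  r-p  = rule N                   defeasible []      p
  r-¬p = rule (suc N)             defeasible []      (∼ p)
  r-q  = rule (suc (suc N))       defeasible []      q
  r-¬q = rule (suc (suc (suc N))) defeasible (p ∷ []) (∼ q)

  Amb : Theory
  Amb = theory [] (r-p ∷ r-¬p ∷ r-q ∷ r-¬q ∷ []) []

  Amb-wf : WellFormed Amb
  Amb-wf = wellFormed-unordered [] (rules Amb)
    (((λ ()) ∷ (λ ()) ∷ (λ ()) ∷ []) ∷ ((λ ()) ∷ (λ ()) ∷ []) ∷ ((λ ()) ∷ []) ∷ [] ∷ [])

  Amb-defeasible : ∀ r → r ∈ rules Amb → kind r ≢ strict
  Amb-defeasible r (here refl) ()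
  Amb-defeasible r (there (here refl)) ()
  Amb-defeasible r (there (there (here refl))) ()
  Amb-defeasible r (there (there (there (here refl)))) ()

  Amb-atoms≥N : ∀ {x} → x ∈Σ Amb → N ≤ x
  Amb-atoms≥N (inj₂ i) = All.lookupWith (λ {r} → atom≥N {r}) bounds i
    where
    bounds : All (λ r → N ≤ atom (head r) × All (λ a → N ≤ atom a) (ante r)) (rules Amb)
    bounds = (≤-refl , []) ∷ (≤-refl , []) ∷ (n≤1+n N , []) ∷ (n≤1+n N , ≤-refl ∷ []) ∷ []
    atom≥N : ∀ {r x} → N ≤ atom (head r) × All (λ a → N ≤ atom a) (ante r) →
             atom (head r) ≡ x ⊎ Any (λ l → atom l ≡ x) (ante r) → N ≤ x
    atom≥N (N≤head , _) (inj₁ eq) = subst (N ≤_) eq N≤head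
    atom≥N (_ , N≤ante) (inj₂ i) = All.lookupWith (λ N≤a eq → subst (N ≤_) eq N≤a) N≤ante i

  Amb-labels≥N : ∀ {l} → l ∈Λ Amb → N ≤ l
  Amb-labels≥N = All.lookup bounds
    where
    bounds : All (N ≤_) (map label (rules Amb))
    bounds = ≤-refl ∷ n≤1+n N ∷ m≤n+m N 2 ∷ m≤n+m N 3 ∷ []

  -- DL(∂) is ambiguity blocking: −∂p is derived because ⇒ p and ⇒ ¬p cancel,
  -- so p ⇒ ¬q no longer attacks q and +∂q follows.
  ambiguity-blocking : Cons∂ Amb ⟨ plus , ∂ , q ⟩
  ambiguity-blocking = _ , +∂q ∷ −Δ ∷ −∂p ∷ −Δ ∷ −Δ ∷ [] , here refl
    where
    −Δ : ∀ {P l} → Step∂ Amb P ⟨ minus , Δ , l ⟩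
    −Δ = noStrict⇒−Δ (rules Amb) [] Amb-defeasible _ _

    refutations : List TL∂
    refutations = ⟨ minus , Δ , ∼ q ⟩ ∷ ⟨ minus , ∂ , p ⟩ ∷ ⟨ minus , Δ , ∼ p ⟩
                  ∷ ⟨ minus , Δ , p ⟩ ∷ []

    -- ⇒ ¬p is applicable and no rule for p is superior to it
    −∂p : ∂Cond Amb (⟨ minus , Δ , ∼ p ⟩ ∷ ⟨ minus , Δ , p ⟩ ∷ []) minus p
    −∂p = there (here refl) ,
          inj₂ (inj₂ (r-¬p , there (here refl) , refl , [] , λ t _ _ _ → inj₂ (λ ())))

    +∂q : ∂Cond Amb refutations plus q
    +∂q = inj₂ (r-q , (there (there (here refl)) , sd-defeasible , refl , []) ,
                here refl , λ s s∈R heads → inj₁ (attack-refuted s s∈R heads))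
      where
      -- the only rule for ¬q has the antecedent p, which is refuted
      attack-refuted : ∀ s → s ∈ rules Amb → head s ≡ ∼ q →
                       Any (λ a → ⟨ minus , ∂ , a ⟩ ∈ refutations) (ante s)
      attack-refuted s (here refl) ()
      attack-refuted s (there (here refl)) ()
      attack-refuted s (there (there (here refl))) ()
      attack-refuted s (there (there (there (here refl)))) refl = here (there (here refl))

  q∈Σ : atom q ∈Σ Amb
  q∈Σ = inj₂ (there (there (here (inj₁ refl))))

∅ : Theory
∅ = theory [] [] []

module AgainstSimulator (D' : Theory) (D'-wf : WellFormed D') where

  N : ℕ
  N = fresh D'

  open Gadget N

  Dx : Theory
  Dx = D' ⊕ Amb

  -- No literal over the gadget's vocabulary is definitely provable: it is
  -- not a fact of D' (fresh) and all rules of the gadget are defeasible.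
  fresh⇒¬+Δ : ∀ {l} → N ≤ atom l → ¬ PΔ Dx plus l
  fresh⇒¬+Δ {l} N≤l = unsupported⇒¬+Δ Dx notFact notStrictHead
    where
    notInD' : ¬ (atom l ∈Σ D')
    notInD' l∈Σ = <⇒≱ (∈Σ⇒<fresh D' l∈Σ) N≤l

    notFact : ¬ (l ∈ facts Dx)
    notFact l∈F with ∈-++⁻ (facts D') l∈F
    ... | inj₁ l∈F' = notInD' (inj₁ (Any.map (λ eq → cong atom (sym eq)) l∈F'))
    ... | inj₂ ()

    notStrictHead : ∀ r → r ∈ rules Dx → kind r ≡ strict → head r ≢ l
    notStrictHead r r∈R isStrict headr with ∈-++⁻ (rules D') r∈R
    ... | inj₁ r∈R' = notInD' (inj₂ (Any.map (λ { refl → inj₁ (cong atom headr) }) r∈R'))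
    ... | inj₂ r∈A  = Amb-defeasible r r∈A isStrict

  -- In DL(∂∥) the ambiguous p is still supported, since ¬p is not definite.
  +λp : Pλ Dx plus p
  +λp = _ , inj₂ (r-p , (∈-++⁺ʳ (rules D') (here refl) , sd-defeasible , refl , []) ,
                  fresh⇒¬+Δ ≤-refl) ∷ [] , here refl

  -- Nothing beats p ⇒ ¬q: superiority pairs of D' relate labels of D',
  -- which are below N, and the gadget has no superiority pairs.
  r-¬q-unbeaten : ∀ t → ¬ (t >[ Dx ] r-¬q)
  r-¬q-unbeaten t t>r with ∈-++⁻ (sup D') t>r
  ... | inj₁ t>r' =
    <⇒≱ (∈Λ⇒<fresh D' (proj₂ (WellFormed.sup-on-rules D'-wf _ _ t>r'))) (m≤n+m N 3)
  ... | inj₂ ()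

  -- DL(∂∥) is ambiguity propagating: the supported, unbeaten attack p ⇒ ¬q
  -- prevents +∂∥q from ever being appended.
  ambiguity-propagation : ¬ Cons∂∥ Dx plus q
  ambiguity-propagation (_ , proof , +q∈P) = go proof +q∈P
    where
    r-¬q∈Dx : r-¬q ∈ rules Dx
    r-¬q∈Dx = ∈-++⁺ʳ (rules D') (there (there (there (here refl))))

    go : ∀ {P} → Proof∂∥ Dx P → (plus , q) ∈ P → ⊥
    go (inj₁ +Δq ∷ _) (here refl) = fresh⇒¬+Δ (n≤1+n N) +Δq
    go (inj₂ (_ , _ , _ , attacks) ∷ _) (here refl) with attacks r-¬q r-¬q∈Dx refl
    ... | inj₁ (here ¬+λp) = ¬+λp +λp
    ... | inj₂ (t , _ , _ , _ , t>r , _) = r-¬q-unbeaten t t>r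
    go (_ ∷ proof) (there i) = go proof i

  modular : Modular ∅ D' Amb
  modular = record
    { sig  = λ x x∈A x∈D' → ⊥-elim (<⇒≱ (∈Σ⇒<fresh D' x∈D') (Amb-atoms≥N x∈A))
    ; lab  = λ l ()
    ; lab' = λ l l∈D' l∈A → <⇒≱ (∈Λ⇒<fresh D' l∈D') (Amb-labels≥N l∈A)
    }

  not-simulating : ¬ Simulates ∅ D'
  not-simulating simulates =
    ambiguity-propagation (Equivalence.to +∂q⇔+∂∥q ambiguity-blocking)
    where
    +∂q⇔+∂∥q : Cons∂ (∅ ⊕ Amb) ⟨ plus , ∂ , q ⟩ ⇔ Cons∂∥ (D' ⊕ Amb) plus q
    +∂q⇔+∂∥q = proj₂ (simulates Amb Amb-wf refl refl modular q q∈Σ) plus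

theorem4 : Σ Theory (λ D → WellFormed D × ((D' : Theory) → WellFormed D' → ¬ Simulates D D'))
theorem4 = ∅ , wellFormed-unordered [] [] [] , AgainstSimulator.not-simulating
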